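{- It is not true that for every graph $G$ and every subgraph $H$ of $G$ one has $\chi_d^{\min}(H)\le \chi_d^{\min}(G)$; that is, there exist a graph $G$ and a subgraph $H$ of $G$ with $\chi_d^{\min}(H)>\chi_d^{\min}(G)$.
   Context: All digraphs are orientations of simple graphs. For a digraph $D$ and $v\in V(D)$, $N^+(v)=\{u: vu\in A(D)\}$. A dominator coloring of $D$ is a partition of $V(D)$ into color classes such that (i) it is a proper coloring of the underlying graph, and (ii) every vertex $v$ with at least one out-neighbor dominates some color class, i.e., there is a color class $C$ with $C\subseteq N^+(v)$; vertices of out-degree $0$ are not required to dominate anything. $\chi_d(D)$ is the minimum number of color classes in a dominator coloring of $D$. For a graph $G$, $\chi_d^{\min}(G)$ denotes the minimum of $\chi_d(D)$ over all orientations $D$ of $G$. -}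

module Defs where

open import Data.Nat using (ℕ; _≤_; _<_)
open import Data.Fin using (Fin)
open import Data.Bool using (Bool; true; false)
open import Data.Product using (Σ; ∃; _×_; _,_)
open import Data.Sum using (_⊎_)
open import Relation.Binary.PropositionalEquality using (_≡_; _≢_)
open import Function.Definitions using (Injective)

record Graph (n : ℕ) : Set where
  field
    adj     : Fin n → Fin n → Bool
    adj-sym : ∀ u v → adj u v ≡ adj v u
    adj-irr : ∀ v → adj v v ≡ false
open Graph public

record Subgraph {m n : ℕ} (H : Graph m) (G : Graph n) : Set where
  field
    emb     : Fin m → Fin n
    emb-inj : Injective _≡_ _≡_ emb
    emb-adj : ∀ u v → adj H u v ≡ true → adj G (emb u) (emb v) ≡ true
open Subgraph public

record Orientation {n : ℕ} (G : Graph n) : Set where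
  field
    arc        : Fin n → Fin n → Bool
    arc-edge   : ∀ u v → arc u v ≡ true → adj G u v ≡ true
    edge-arc   : ∀ u v → adj G u v ≡ true →
                   (arc u v ≡ true × arc v u ≡ false) ⊎ (arc u v ≡ false × arc v u ≡ true)
open Orientation public

record DominatorColoring {n : ℕ} (G : Graph n) (D : Orientation G) (k : ℕ) : Set where
  field
    color      : Fin n → Fin k
    surjective : ∀ (i : Fin k) → ∃ λ v → color v ≡ i
    proper     : ∀ u v → adj G u v ≡ true → color u ≢ color v
    dominating : ∀ v → (∃ λ u → arc D v u ≡ true) →
                   ∃ λ (i : Fin k) → ∀ u → color u ≡ i → arc D v u ≡ true
open DominatorColoring public

HasOrientedDomColoring : {n : ℕ} → Graph n → ℕ → Set
HasOrientedDomColoring G k = Σ (Orientation G) λ D → DominatorColoring G D k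

ChiDMin : {n : ℕ} → Graph n → ℕ → Set
ChiDMin G k = HasOrientedDomColoring G k × (∀ j → HasOrientedDomColoring G j → k ≤ j)

-- In the 4-cycle orient both edges at 0 and both edges at 2 outwards: the
-- sources 0 and 2 then dominate the class {1, 3} of the proper 2-colouring,
-- so χ_d^min(C₄) = 2. The perfect matching {01, 23} needs 3 colours: in a
-- 2-colouring every edge meets both classes, so a vertex dominating a class
-- must be adjacent to an end of every edge, while the tail of the arc on 01
-- sees neither end of 23.
module Submission where

open import Defs
open import Data.Nat using (ℕ; zero; suc; _<_; _≤_; z≤n; s≤s)
open import Data.Nat.Properties using (≤∧≢⇒<; n<1+n)
open import Data.Fin using (Fin; zero) renaming (_≟_ to _≟ᶠ_)
open import Data.Fin.Patterns using (0F; 1F; 2F; 3F)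
open import Data.Fin.Properties using (all?; any?)
open import Data.Bool using (Bool; true; false; _∨_) renaming (_≟_ to _≟ᵇ_)
open import Data.Bool.Properties using (∨-comm; not-¬)
open import Data.Product using (Σ; ∃; _×_; _,_)
open import Data.Sum using (_⊎_; inj₁; inj₂)
open import Relation.Nullary using (¬_; contradiction)
open import Relation.Nullary.Decidable using (Dec; True; toWitness; from-yes; _→-dec_; _×-dec_; ¬?)
open import Relation.Binary.PropositionalEquality using (_≡_; _≢_; refl)

module _ {n : ℕ} (arrow : Fin n → Fin n → Bool)
         (asym : ∀ u v → arrow u v ≡ true → arrow v u ≡ false) where

  underlying : Graph n
  underlying = record
    { adj     = λ u v → arrow u v ∨ arrow v u
    ; adj-sym = λ u v → ∨-comm (arrow u v) (arrow v u)
    ; adj-irr = irreflexive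
    }
    where
    irreflexive : ∀ v → arrow v v ∨ arrow v v ≡ false
    irreflexive v with arrow v v in eq
    ... | true  = contradiction (asym v v eq) (not-¬ eq)
    ... | false = refl

  orientation : Orientation underlying
  orientation = record { arc = arrow ; arc-edge = arc-edge′ ; edge-arc = edge-arc′ }
    where
    arc-edge′ : ∀ u v → arrow u v ≡ true → arrow u v ∨ arrow v u ≡ true
    arc-edge′ u v eq rewrite eq = refl

    edge-arc′ : ∀ u v → arrow u v ∨ arrow v u ≡ true →
                (arrow u v ≡ true × arrow v u ≡ false) ⊎ (arrow u v ≡ false × arrow v u ≡ true)
    edge-arc′ u v edge with arrow u v in eq
    ... | true  = inj₁ (refl , asym u v eq)
    ... | false = inj₂ (refl , edge)

underlying-mono : ∀ {n} {arrowₕ arrowɢ : Fin n → Fin n → Bool}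
                  {asymₕ : ∀ u v → arrowₕ u v ≡ true → arrowₕ v u ≡ false}
                  {asymɢ : ∀ u v → arrowɢ u v ≡ true → arrowɢ v u ≡ false} →
                  (∀ u v → arrowₕ u v ≡ true → arrowɢ u v ≡ true) →
                  Subgraph (underlying arrowₕ asymₕ) (underlying arrowɢ asymɢ)
underlying-mono {arrowₕ = arrowₕ} {arrowɢ} ⊆ = record
  { emb = λ v → v ; emb-inj = λ eq → eq ; emb-adj = edge }
  where
  edge : ∀ u v → arrowₕ u v ∨ arrowₕ v u ≡ true → arrowɢ u v ∨ arrowɢ v u ≡ true
  edge u v h with arrowₕ u v in huv | arrowₕ v u in hvu
  ... | true  | _ rewrite ⊆ u v huv = refl
  ... | false | true rewrite ⊆ v u hvu = ∨-comm (arrowɢ u v) true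

edge⇒2≤colours : ∀ {n k} {G : Graph n} {D : Orientation G} → DominatorColoring G D k →
                 ∀ {u v} → adj G u v ≡ true → 2 ≤ k
edge⇒2≤colours {k = zero}        c {u} _  with color c u
... | ()
edge⇒2≤colours {k = suc zero}    c {u} {v} uv with color c u | color c v | proper c u v uv
... | zero | zero | ≢ = contradiction refl ≢
edge⇒2≤colours {k = suc (suc _)} c _  = s≤s (s≤s z≤n)

≢⇒covers-Fin2 : ∀ {x y : Fin 2} → x ≢ y → ∀ i → x ≡ i ⊎ y ≡ i
≢⇒covers-Fin2 {0F} {0F} x≢y _  = contradiction refl x≢y
≢⇒covers-Fin2 {1F} {1F} x≢y _  = contradiction refl x≢y
≢⇒covers-Fin2 {0F} {1F} _   0F = inj₁ refl
≢⇒covers-Fin2 {0F} {1F} _   1F = inj₂ refl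
≢⇒covers-Fin2 {1F} {0F} _   0F = inj₂ refl
≢⇒covers-Fin2 {1F} {0F} _   1F = inj₁ refl

dominator-sees-every-edge : ∀ {n} {G : Graph n} {D : Orientation G} → DominatorColoring G D 2 →
                            ∀ {t h x y} → arc D t h ≡ true → adj G x y ≡ true →
                            adj G t x ≡ true ⊎ adj G t y ≡ true
dominator-sees-every-edge {D = D} c {t} {h} {x} {y} th xy
  with dominating c t (h , th)
... | i , dominated with ≢⇒covers-Fin2 (proper c x y xy) i
...   | inj₁ xi = inj₁ (arc-edge D t x (dominated x xi))
...   | inj₂ yi = inj₂ (arc-edge D t y (dominated y yi))

SeesNoEndOf : ∀ {n} → Graph n → Fin n → Fin n → Fin n → Set
SeesNoEndOf G t x y = adj G t x ≡ false × adj G t y ≡ false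

blind-to : ∀ {n} (G : Graph n) {t x y} → SeesNoEndOf G t x y →
           ¬ (adj G t x ≡ true ⊎ adj G t y ≡ true)
blind-to _ (tx , _) (inj₁ tx′) = not-¬ tx′ tx
blind-to _ (_ , ty) (inj₂ ty′) = not-¬ ty′ ty

two-far-edges⇒no-2-colouring : ∀ {n} {G : Graph n} {a b x y} →
                               adj G a b ≡ true → adj G x y ≡ true →
                               SeesNoEndOf G a x y → SeesNoEndOf G b x y →
                               (D : Orientation G) → ¬ DominatorColoring G D 2
two-far-edges⇒no-2-colouring {G = G} {a} {b} ab xy a∌ b∌ D c with edge-arc D a b ab
... | inj₁ (a→b , _) = blind-to G a∌ (dominator-sees-every-edge c a→b xy)
... | inj₂ (_ , b→a) = blind-to G b∌ (dominator-sees-every-edge c b→a xy)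

asymmetric? : ∀ {n} (arrow : Fin n → Fin n → Bool) →
              Dec (∀ u v → arrow u v ≡ true → arrow v u ≡ false)
asymmetric? arrow = all? λ u → all? λ v → (arrow u v ≟ᵇ true) →-dec (arrow v u ≟ᵇ false)

module _ {n k : ℕ} (G : Graph n) (D : Orientation G) (colour : Fin n → Fin k) where

  surjective? : Dec (∀ i → ∃ λ v → colour v ≡ i)
  surjective? = all? λ i → any? λ v → colour v ≟ᶠ i

  proper? : Dec (∀ u v → adj G u v ≡ true → colour u ≢ colour v)
  proper? = all? λ u → all? λ v → (adj G u v ≟ᵇ true) →-dec ¬? (colour u ≟ᶠ colour v)

  dominating? : Dec (∀ v → (∃ λ u → arc D v u ≡ true) →
                     ∃ λ i → ∀ u → colour u ≡ i → arc D v u ≡ true)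
  dominating? = all? λ v → any? (λ u → arc D v u ≟ᵇ true) →-dec
                any? λ i → all? λ u → (colour u ≟ᶠ i) →-dec (arc D v u ≟ᵇ true)

  dominator-coloring : {True (surjective? ×-dec proper? ×-dec dominating?)} →
                      DominatorColoring G D k
  dominator-coloring {checked} with toWitness checked
  ... | onto , proper′ , dominating′ = record
    { color = colour ; surjective = onto ; proper = proper′ ; dominating = dominating′ }

square-arrows : Fin 4 → Fin 4 → Bool
square-arrows 0F 1F = true
square-arrows 0F 3F = true
square-arrows 2F 1F = true
square-arrows 2F 3F = true
square-arrows _  _  = false

matching-arrows : Fin 4 → Fin 4 → Bool
matching-arrows 0F 1F = true
matching-arrows 2F 3F = true
matching-arrows _  _  = false

square : Graph 4
square = underlying square-arrows (from-yes (asymmetric? square-arrows))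

matching : Graph 4
matching = underlying matching-arrows (from-yes (asymmetric? matching-arrows))

matching⊆square : Subgraph matching square
matching⊆square = underlying-mono (from-yes (all? λ u → all? λ v →
  (matching-arrows u v ≟ᵇ true) →-dec (square-arrows u v ≟ᵇ true)))

square-parity : Fin 4 → Fin 2
square-parity 0F = 0F
square-parity 1F = 1F
square-parity 2F = 0F
square-parity 3F = 1F

matching-colouring : Fin 4 → Fin 3
matching-colouring 1F = 0F
matching-colouring 3F = 1F
matching-colouring _  = 2F

χd-square : ChiDMin square 2
χd-square = (_ , dominator-coloring square (orientation _ _) square-parity)
          , λ _ (_ , c) → edge⇒2≤colours c {0F} {1F} refl

χd-matching : ChiDMin matching 3
χd-matching = (_ , dominator-coloring matching (orientation _ _) matching-colouring)
            , λ j (D , c) → ≤∧≢⇒< (edge⇒2≤colours c {0F} {1F} refl) λ { refl →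
                two-far-edges⇒no-2-colouring {a = 0F} {1F} {2F} {3F}
                  refl refl (refl , refl) (refl , refl) D c }

lemma1 : Σ ℕ λ n → Σ (Graph n) λ G → Σ ℕ λ m → Σ (Graph m) λ H → Subgraph H G × Σ ℕ λ a → Σ ℕ λ b → ChiDMin G a × ChiDMin H b × a < b
lemma1 = 4 , square , 4 , matching , matching⊆square , 2 , 3 , χd-square , χd-matching , n<1+n 2
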